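{- Let $\mathcal{C}=\{c_1,\ldots,c_m\}$ be a collection of cliques with graph union $U$ on vertex set $V$. The partition of $V$ into the nonempty sets among $\{\Gamma_J: \emptyset\neq J\subseteq\{1,\ldots,m\}\}$ is an orbit partition of $U$: there is a group of automorphisms of $U$ whose orbits on $V$ are exactly these nonempty sets $\Gamma_J$.
   Context: A clique is identified with its vertex set. The graph union $U$ of $c_1,\ldots,c_m$ has vertex set $V=\bigcup_j c_j$, and distinct $u,v\in V$ are adjacent iff $u,v\in c_j$ for some $j$. For $J\subseteq\{1,\ldots,m\}$, $\Gamma_J$ is the set of $v\in V$ with $\{j:v\in c_j\}=J$. -}

module Defs where

open import Data.Nat using (ℕ)
open import Data.Fin using (Fin)
open import Data.Fin.Subset using (Subset; _∈_; Nonempty)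
open import Data.Fin.Permutation using (Permutation′; _⟨$⟩ʳ_; id; flip; _∘ₚ_)
open import Data.Product using (_×_; ∃-syntax; Σ-syntax)
open import Relation.Binary.PropositionalEquality using (_≡_)
open import Relation.Nullary using (¬_)
open import Function.Bundles using (_⇔_)

-- A collection of m cliques c₁,…,cₘ, each a (finite) vertex set, given as
-- subsets of Fin n.  The vertex set V = ⋃ c_j is taken to be all of Fin n
-- (see `Covers`).
Cliques : ℕ → ℕ → Set
Cliques m n = Fin m → Subset n

Covers : ∀ {m n} → Cliques m n → Set
Covers c = ∀ v → ∃[ j ] (v ∈ c j)

Adj : ∀ {m n} → Cliques m n → Fin n → Fin n → Set
Adj c u v = ¬ (u ≡ v) × ∃[ j ] (u ∈ c j × v ∈ c j)

_∈Γ_ : ∀ {m n} {c : Cliques m n} → Fin n → Subset m → Set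
_∈Γ_ {c = c} v J = ∀ j → (v ∈ c j ⇔ j ∈ J)

InΓ : ∀ {m n} → Cliques m n → Subset m → Fin n → Set
InΓ c J v = _∈Γ_ {c = c} v J

IsAutomorphism : ∀ {m n} → Cliques m n → Permutation′ n → Set
IsAutomorphism c σ = ∀ u v → (Adj c u v ⇔ Adj c (σ ⟨$⟩ʳ u) (σ ⟨$⟩ʳ v))

record IsAutGroup {m n} (c : Cliques m n) (G : Permutation′ n → Set) : Set where
  field
    automorphisms : ∀ σ → G σ → IsAutomorphism c σ
    has-id        : G id
    closed-∘      : ∀ σ τ → G σ → G τ → G (σ ∘ₚ τ)
    closed-⁻¹     : ∀ σ → G σ → G (flip σ)

SameOrbit : ∀ {n} → (Permutation′ n → Set) → Fin n → Fin n → Set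
SameOrbit G u v = ∃[ σ ] (G σ × σ ⟨$⟩ʳ u ≡ v)

-- A permutation that maps every clique onto itself preserves adjacency in the
-- union, and such permutations form a group. Its orbits are the Γ_J: a
-- permutation fixing every clique setwise fixes the set of cliques containing
-- each vertex, and conversely two vertices with the same set of cliques are
-- swapped by the transposition exchanging them, which fixes every clique.
module Submission where

open import Defs
open import Data.Nat using (ℕ)
import Data.Nat as ℕ
open import Data.Fin using (Fin; zero; suc)
open import Data.Fin.Properties using (_≟_)
open import Data.Fin.Subset using (Subset; Nonempty; _∈_)
open import Data.Fin.Subset.Properties using (_∈?_)
open import Data.Fin.Permutation
  using (Permutation′; _⟨$⟩ʳ_; _⟨$⟩ˡ_; id; flip; _∘ₚ_; transpose; inverseʳ)
open import Data.Vec.Base using (_∷_; []; here; there)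
open import Data.Product using (_×_; ∃-syntax; Σ-syntax; _,_)
open import Function.Base using (_∘_)
open import Function.Bundles using (_⇔_; mk⇔; Equivalence; Injection)
open import Function.Construct.Identity using (⇔-id)
open import Function.Construct.Symmetry using (⇔-sym)
open import Function.Construct.Composition using (_⇔-∘_)
open import Function.Properties.Inverse using (↔⇒↣)
open import Relation.Nullary using (yes; no; does; contradiction)
open import Relation.Nullary.Decidable using (dec-true)
open import Relation.Unary using (Decidable)
open import Relation.Binary.PropositionalEquality using (_≡_; refl; cong; subst)

open Equivalence using (to; from)

toSubset : ∀ {n} {P : Fin n → Set} → Decidable P → Subset n
toSubset {ℕ.zero}  P? = []
toSubset {ℕ.suc n} P? = does (P? zero) ∷ toSubset (P? ∘ suc)

∈-toSubset : ∀ {n} {P : Fin n → Set} (P? : Decidable P) x → x ∈ toSubset P? ⇔ P x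
∈-toSubset P? zero with P? zero
... | yes p = mk⇔ (λ _ → p) (λ _ → here)
... | no ¬p = mk⇔ (λ ()) (λ p → contradiction p ¬p)
∈-toSubset P? (suc x) = ∈-toSubset (P? ∘ suc) x ⇔-∘ mk⇔ (λ { (there x∈) → x∈ }) there

Preserves : ∀ {n} → (Fin n → Set) → Permutation′ n → Set
Preserves P σ = ∀ w → P w ⇔ P (σ ⟨$⟩ʳ w)

module _ {n} {P : Fin n → Set} where

  id-preserves : Preserves P id
  id-preserves w = ⇔-id _

  ∘-preserves : ∀ {σ τ} → Preserves P σ → Preserves P τ → Preserves P (σ ∘ₚ τ)
  ∘-preserves {σ} σ-P τ-P w = τ-P (σ ⟨$⟩ʳ w) ⇔-∘ σ-P w

  flip-preserves : ∀ {σ} → Preserves P σ → Preserves P (flip σ)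
  flip-preserves {σ} σ-P w =
    subst (λ x → P x ⇔ P (σ ⟨$⟩ˡ w)) (inverseʳ σ) (⇔-sym (σ-P (σ ⟨$⟩ˡ w)))

  transpose-preserves : ∀ {u v} → (P u ⇔ P v) → Preserves P (transpose u v)
  transpose-preserves {u} {v} Pu⇔Pv w with w ≟ u
  ... | yes refl = Pu⇔Pv
  ... | no _ with w ≟ v
  ...   | yes refl = ⇔-sym Pu⇔Pv
  ...   | no _     = ⇔-id _

transpose-maps : ∀ {n} (u v : Fin n) → transpose u v ⟨$⟩ʳ u ≡ v
transpose-maps u v rewrite dec-true (u ≟ u) refl = refl

module _ {m n} (c : Cliques m n) where

  CliqueStabiliser : Permutation′ n → Set
  CliqueStabiliser σ = ∀ j → Preserves (_∈ c j) σ

  stabiliser-automorphism : ∀ σ → CliqueStabiliser σ → IsAutomorphism c σ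
  stabiliser-automorphism σ σ-c u v = mk⇔
    (λ (u≢v , j , u∈ , v∈) →
      u≢v ∘ Injection.injective (↔⇒↣ σ) , j , to (σ-c j u) u∈ , to (σ-c j v) v∈)
    (λ (σu≢σv , j , σu∈ , σv∈) →
      σu≢σv ∘ cong (σ ⟨$⟩ʳ_) , j , from (σ-c j u) σu∈ , from (σ-c j v) σv∈)

  stabiliser-autGroup : IsAutGroup c CliqueStabiliser
  stabiliser-autGroup = record
    { automorphisms = stabiliser-automorphism
    ; has-id        = λ j → id-preserves
    ; closed-∘      = λ σ τ σ-c τ-c j → ∘-preserves {σ = σ} {τ} (σ-c j) (τ-c j)
    ; closed-⁻¹     = λ σ σ-c j → flip-preserves {σ = σ} (σ-c j)
    }

  cliquesOf : Fin n → Subset m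
  cliquesOf v = toSubset (λ j → v ∈? c j)

  ∈Γ-cliquesOf : ∀ v → InΓ c (cliquesOf v) v
  ∈Γ-cliquesOf v j = ⇔-sym (∈-toSubset (λ j → v ∈? c j) j)

  cliquesOf-nonempty : Covers c → ∀ v → Nonempty (cliquesOf v)
  cliquesOf-nonempty cover v with cover v
  ... | j , v∈cⱼ = j , to (∈Γ-cliquesOf v j) v∈cⱼ

  sameOrbit⇒sameΓ : Covers c → ∀ u v → SameOrbit CliqueStabiliser u v →
    ∃[ J ] (Nonempty J × InΓ c J u × InΓ c J v)
  sameOrbit⇒sameΓ cover u _ (σ , σ-c , refl) =
    cliquesOf u , cliquesOf-nonempty cover u , ∈Γ-cliquesOf u ,
    λ j → ∈Γ-cliquesOf u j ⇔-∘ ⇔-sym (σ-c j u)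

  sameΓ⇒sameOrbit : ∀ {J} u v → InΓ c J u → InΓ c J v → SameOrbit CliqueStabiliser u v
  sameΓ⇒sameOrbit u v u∈Γ v∈Γ =
    transpose u v , (λ j → transpose-preserves (⇔-sym (v∈Γ j) ⇔-∘ u∈Γ j)) , transpose-maps u v

proposition4p5 : (m n : ℕ) (c : Cliques m n) → Covers c →
    Σ[ G ∈ (Permutation′ n → Set) ]
      (IsAutGroup c G ×
       (∀ u v → (SameOrbit G u v ⇔
          (∃[ J ] (Nonempty J × InΓ c J u × InΓ c J v)))))
proposition4p5 m n c cover =
  CliqueStabiliser c , stabiliser-autGroup c , λ u v → mk⇔
    (sameOrbit⇒sameΓ c cover u v)
    (λ (_ , _ , u∈Γ , v∈Γ) → sameΓ⇒sameOrbit c u v u∈Γ v∈Γ)
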